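{- Let $\mathscr{A}$ be a closed set of games with $\mathscr{A}\neq\emptyset$ and $\mathscr{A}\neq\{0\}$, and let $(\mathcal{Q},\mathcal{P})=\mathcal{Q}(\mathscr{A})$ be its mis\`ere quotient. Then for every $x\in\mathcal{Q}$ there exists $y\in\mathcal{Q}$ with $xy\in\mathcal{P}$.
   Context: Games are finite, loopfree impartial games identified with their sets of options ($0=\{\}$); disjunctive sum $G+H=\{G'+H\}\cup\{G+H'\}$. Mis\`ere outcome: $o^-(G)=\mathscr{P}$ iff $G\neq0$ and every option has outcome $\mathscr{N}$; otherwise $\mathscr{N}$. A set of games is closed if closed under sum and under taking options. For $G,H\in\mathscr{A}$, $G\equiv_\mathscr{A}H$ iff $o^-(G+X)=o^-(H+X)$ for all $X\in\mathscr{A}$. The mis\`ere quotient is $\mathcal{Q}=\mathscr{A}/\!\equiv_\mathscr{A}$ with multiplication $[G][H]=[G+H]$, and $\mathcal{P}=\{[G]: o^-(G)=\mathscr{P}\}$. -}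

module Defs where

open import Data.List using (List; []; _∷_; _++_)
open import Data.List.Membership.Propositional using (_∈_)
open import Data.Product using (Σ; _×_; ∃)
open import Relation.Binary.PropositionalEquality using (_≡_)
open import Relation.Nullary using (¬_)

-- A finite loopfree impartial game, given by its (finite) list of options.
data Game : Set where
  node : List Game → Game

zeroG : Game
zeroG = node []

options : Game → List Game
options (node gs) = gs

mutual
  _⊕_ : Game → Game → Game
  node gs ⊕ node hs = node (plusL gs (node hs) ++ plusR (node gs) hs)

  plusL : List Game → Game → List Game
  plusL [] h = []
  plusL (g ∷ gs) h = (g ⊕ h) ∷ plusL gs h

  plusR : Game → List Game → List Game
  plusR g [] = []
  plusR g (h ∷ hs) = (g ⊕ h) ∷ plusR g hs

infixl 6 _⊕_

data Outcome : Set where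
  𝒫 𝒩 : Outcome

mutual
  o⁻ : Game → Outcome
  o⁻ (node []) = 𝒩
  o⁻ (node (g ∷ gs)) = allN (g ∷ gs)

  allN : List Game → Outcome
  allN [] = 𝒫
  allN (g ∷ gs) with o⁻ g
  ... | 𝒫 = 𝒩
  ... | 𝒩 = allN gs

record Closed (A : Game → Set) : Set where
  field
    sum-closed    : ∀ {G H} → A G → A H → A (G ⊕ H)
    option-closed : ∀ {G G′} → A G → G′ ∈ options G → A G′

_≡[_]_ : Game → (Game → Set) → Game → Set
G ≡[ A ] H = ∀ X → A X → o⁻ (G ⊕ X) ≡ o⁻ (H ⊕ X)

-- The class [G] (G ∈ A) lies in 𝒫 = {[K] : K ∈ A, o⁻(K) = 𝒫}.
InP : (Game → Set) → Game → Set
InP A G = Σ Game λ K → A K × (K ≡[ A ] G) × (o⁻ K ≡ 𝒫)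

{-# OPTIONS --safe #-}
-- If G ≠ 0, the game G + G is either a misère 𝒫-position or, being a nonzero
-- 𝒩-position, has a 𝒫-position among its options G′ + G and G + G′; since the
-- outcome of a sum is symmetric, H = G or H = G′ works.  If G = 0, any
-- 𝒫-position of 𝒜 works, and one exists: a nonzero game of 𝒜 is a 𝒫-position
-- or has one as an option.
module Submission where

open import Defs
open import Data.Product using (Σ; _×_; _,_)
open import Data.Sum using (_⊎_; inj₁; inj₂; reduce; map₁)
open import Data.List using ([]; _∷_; _++_; map)
open import Data.List.Relation.Unary.All as All using (All; _∷_)
open import Data.List.Relation.Unary.Any as Any using (Any; here; there)
open import Data.List.Relation.Unary.Any.Properties using (++⁻; map⁻)
open import Relation.Binary.PropositionalEquality
  using (_≡_; _≢_; refl; sym; trans; cong; cong₂; subst; module ≡-Reasoning)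
open import Relation.Nullary using (¬_; contradiction)

Is𝒫 : Game → Set
Is𝒫 G = o⁻ G ≡ 𝒫

-- Conjunction with 𝒫 read as true; allN gs is the conjunction of the negated outcomes of gs.
_∧_ : Outcome → Outcome → Outcome
𝒫 ∧ o = o
𝒩 ∧ _ = 𝒩

∧-comm : ∀ o p → o ∧ p ≡ p ∧ o
∧-comm 𝒫 𝒫 = refl
∧-comm 𝒫 𝒩 = refl
∧-comm 𝒩 𝒫 = refl
∧-comm 𝒩 𝒩 = refl

allN-++ : ∀ gs hs → allN (gs ++ hs) ≡ allN gs ∧ allN hs
allN-++ []       hs = refl
allN-++ (g ∷ gs) hs with o⁻ g
... | 𝒫 = refl
... | 𝒩 = allN-++ gs hs

allN≡𝒩⇒Any𝒫 : ∀ {gs} → allN gs ≡ 𝒩 → Any Is𝒫 gs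
allN≡𝒩⇒Any𝒫 {g ∷ gs} allN≡𝒩 with o⁻ g in g∈𝒫
... | 𝒫 = here g∈𝒫
... | 𝒩 = there (allN≡𝒩⇒Any𝒫 allN≡𝒩)

𝒫-self-or-option : ∀ {G} → G ≢ zeroG → Any Is𝒫 (G ∷ options G)
𝒫-self-or-option {node []}       G≢0 = contradiction refl G≢0
𝒫-self-or-option {node (g ∷ gs)} _ with allN (g ∷ gs) in G∈𝒫
... | 𝒫 = here G∈𝒫
... | 𝒩 = there (allN≡𝒩⇒Any𝒫 G∈𝒫)

-- The empty sum is split off so that o⁻ of a nonempty option list reduces to allN.
mutual
  o⁻-comm : ∀ G H → o⁻ (G ⊕ H) ≡ o⁻ (H ⊕ G)
  o⁻-comm (node [])       (node [])       = refl
  o⁻-comm (node [])       (node (h ∷ hs)) = allN-options-⊕-comm [] (h ∷ hs)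
  o⁻-comm (node (g ∷ gs)) (node [])       = allN-options-⊕-comm (g ∷ gs) []
  o⁻-comm (node (g ∷ gs)) (node (h ∷ hs)) = allN-options-⊕-comm (g ∷ gs) (h ∷ hs)

  allN-options-⊕-comm : ∀ gs hs →
    allN (options (node gs ⊕ node hs)) ≡ allN (options (node hs ⊕ node gs))
  allN-options-⊕-comm gs hs = begin
    allN (plusL gs (node hs) ++ plusR (node gs) hs)
      ≡⟨ allN-++ (plusL gs (node hs)) _ ⟩
    allN (plusL gs (node hs)) ∧ allN (plusR (node gs) hs)
      ≡⟨ cong₂ _∧_ (allN-plusL≡allN-plusR gs (node hs)) (sym (allN-plusL≡allN-plusR hs (node gs))) ⟩
    allN (plusR (node hs) gs) ∧ allN (plusL hs (node gs))
      ≡⟨ ∧-comm (allN (plusR (node hs) gs)) _ ⟩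
    allN (plusL hs (node gs)) ∧ allN (plusR (node hs) gs)
      ≡⟨ sym (allN-++ (plusL hs (node gs)) _) ⟩
    allN (plusL hs (node gs) ++ plusR (node hs) gs)
      ∎
    where open ≡-Reasoning

  allN-plusL≡allN-plusR : ∀ gs H → allN (plusL gs H) ≡ allN (plusR H gs)
  allN-plusL≡allN-plusR []       _ = refl
  allN-plusL≡allN-plusR (g ∷ gs) H with o⁻ (g ⊕ H) | o⁻ (H ⊕ g) | o⁻-comm g H
  ... | 𝒫 | .𝒫 | refl = refl
  ... | 𝒩 | .𝒩 | refl = allN-plusL≡allN-plusR gs H

mutual
  ⊕-identityˡ : ∀ G → zeroG ⊕ G ≡ G
  ⊕-identityˡ (node hs) = cong node (plusR-identityˡ hs)

  plusR-identityˡ : ∀ hs → plusR zeroG hs ≡ hs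
  plusR-identityˡ []       = refl
  plusR-identityˡ (h ∷ hs) = cong₂ _∷_ (⊕-identityˡ h) (plusR-identityˡ hs)

⊕-nonzeroˡ : ∀ G H → G ≢ zeroG → G ⊕ H ≢ zeroG
⊕-nonzeroˡ (node [])      _        G≢0 = contradiction refl G≢0
⊕-nonzeroˡ (node (_ ∷ _)) (node _)  _   = λ ()

plusL≡map : ∀ gs H → plusL gs H ≡ map (_⊕ H) gs
plusL≡map []       _ = refl
plusL≡map (g ∷ gs) H = cong (g ⊕ H ∷_) (plusL≡map gs H)

plusR≡map : ∀ G hs → plusR G hs ≡ map (G ⊕_) hs
plusR≡map _ []       = refl
plusR≡map G (h ∷ hs) = cong (G ⊕ h ∷_) (plusR≡map G hs)

options-⊕ : ∀ G H → options (G ⊕ H) ≡ map (_⊕ H) (options G) ++ map (G ⊕_) (options H)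
options-⊕ (node gs) (node hs) = cong₂ _++_ (plusL≡map gs (node hs)) (plusR≡map (node gs) hs)

Any-options-⊕⁻ : ∀ {P : Game → Set} G H → Any P (options (G ⊕ H)) →
  Any (λ G′ → P (G′ ⊕ H)) (options G) ⊎ Any (λ H′ → P (G ⊕ H′)) (options H)
Any-options-⊕⁻ {P} G H p with ++⁻ (map (_⊕ H) (options G)) (subst (Any P) (options-⊕ G H) p)
... | inj₁ q = inj₁ (map⁻ q)
... | inj₂ q = inj₂ (map⁻ q)

𝒫-option-of-double : ∀ G → Any Is𝒫 (options (G ⊕ G)) → Any (λ H → Is𝒫 (G ⊕ H)) (options G)
𝒫-option-of-double G p =
  reduce (map₁ (Any.map (λ {H} H⊕G∈𝒫 → trans (o⁻-comm G H) H⊕G∈𝒫)) (Any-options-⊕⁻ G G p))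

𝒫⇒InP : ∀ {A G} → A G → Is𝒫 G → InP A G
𝒫⇒InP {G = G} G∈A G∈𝒫 = G , G∈A , (λ _ _ → refl) , G∈𝒫

module _ {A : Game → Set} (closed : Closed A) where
  open Closed closed

  options-closed : ∀ {G} → A G → All A (options G)
  options-closed G∈A = All.tabulate (option-closed G∈A)

  witness-in : ∀ {P : Game → Set} {gs} → All A gs → Any P gs → Σ Game (λ G → A G × P G)
  witness-in all p = Any.lookup p , All.lookupAny all p

  𝒫-position : Σ Game (λ T → A T × T ≢ zeroG) → Σ Game (λ Y → A Y × Is𝒫 Y)
  𝒫-position (T , T∈A , T≢0) = witness-in (T∈A ∷ options-closed T∈A) (𝒫-self-or-option T≢0)

  𝒫-partner : Σ Game (λ T → A T × T ≢ zeroG) → ∀ {G} → A G → Σ Game (λ H → A H × Is𝒫 (G ⊕ H))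
  𝒫-partner T {node []} _ with 𝒫-position T
  ... | Y , Y∈A , Y∈𝒫 = Y , Y∈A , subst Is𝒫 (sym (⊕-identityˡ Y)) Y∈𝒫
  𝒫-partner _ {G@(node (_ ∷ _))} G∈A with 𝒫-self-or-option (⊕-nonzeroˡ G G (λ ()))
  ... | here G⊕G∈𝒫 = G , G∈A , G⊕G∈𝒫
  ... | there p    = witness-in (options-closed G∈A) (𝒫-option-of-double G p)

mainTheorem13 : (A : Game → Set) → Closed A
    → Σ Game A
    → Σ Game (λ G → A G × ¬ (G ≡ zeroG))
    → ∀ G → A G → Σ Game (λ H → A H × InP A (G ⊕ H))
mainTheorem13 A closed _ T G G∈A with 𝒫-partner closed T G∈A
... | H , H∈A , G⊕H∈𝒫 = H , H∈A , 𝒫⇒InP (Closed.sum-closed closed G∈A H∈A) G⊕H∈𝒫
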